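{- Let $G$ be a nontrivial graph such that every set of vertices $S\subseteq V(G)$ with $2\le |S|\le 4$ contains two vertices $x,y\in S$ with $x\notin I[S\setminus\{x\}]$ and $y\notin I[S\setminus\{y\}]$. Then, for every integer $k\ge 2$, $g(G\boxtimes C_{2k+1})\ge 5$.
   Context: All graphs are finite, simple and connected. For vertices $x,y$ of a graph, the closed interval $I[x,y]$ consists of $x$, $y$ and all vertices lying on some shortest $x$–$y$ path; for a vertex set $S$, $I[S]=\bigcup_{u,v\in S}I[u,v]$. A set $S$ is geodetic if $I[S]=V(G)$, and the geodetic number $g(G)$ is the minimum cardinality of a geodetic set. $C_{2k+1}$ is the cycle of order $2k+1$. The strong product $G\boxtimes H$ has vertex set $V(G)\times V(H)$, with $(g,h)$ and $(g',h')$ adjacent whenever ($g=g'$ and $hh'\in E(H)$), or ($h=h'$ and $gg'\in E(G)$), or ($gg'\in E(G)$ and $hh'\in E(H)$). -}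

module Defs where

open import Data.Nat using (ℕ; zero; suc; _+_; _*_; _≤_; _%_)
open import Data.Fin using (Fin; toℕ)
open import Data.Product using (Σ; ∃; _×_; _,_)
open import Data.Sum using (_⊎_)
open import Data.List using (List; length)
open import Data.List.Membership.Propositional using (_∈_)
open import Data.List.Relation.Unary.Unique.Propositional using (Unique)
open import Relation.Binary.PropositionalEquality using (_≡_; _≢_)
open import Relation.Nullary using (¬_)
open import Function.Bundles using (_↔_)

record RawGraph : Set₁ where
  field
    V   : Set
    Adj : V → V → Set
open RawGraph public

data Walk (G : RawGraph) : V G → V G → Set where
  []  : (x : V G) → Walk G x x
  _∷_ : {x y z : V G} → Adj G x y → Walk G y z → Walk G x z

wlength : {G : RawGraph} {x y : V G} → Walk G x y → ℕ
wlength ([] x)  = zero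
wlength (a ∷ w) = suc (wlength w)

Visits : {G : RawGraph} {x y : V G} → Walk G x y → V G → Set
Visits ([] x) z = z ≡ x
Visits (_∷_ {x} a w) z = z ≡ x ⊎ Visits w z

-- shortest walk (= shortest path, since a shortest walk never repeats vertices)
Shortest : {G : RawGraph} {x y : V G} → Walk G x y → Set
Shortest {G} {x} {y} w = (w' : Walk G x y) → wlength w ≤ wlength w'

InInterval : (G : RawGraph) → V G → V G → V G → Set
InInterval G x y z = Σ (Walk G x y) λ w → Shortest w × Visits w z

InIntervalSet : (G : RawGraph) → (V G → Set) → V G → Set
InIntervalSet G S z = Σ (V G) λ u → Σ (V G) λ v → S u × S v × InInterval G u v z

InList : {A : Set} → List A → A → Set
InList S v = v ∈ S

Minus : {A : Set} → List A → A → A → Set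
Minus S x v = v ∈ S × v ≢ x

Geodetic : (G : RawGraph) → List (V G) → Set
Geodetic G S = (z : V G) → InIntervalSet G (InList S) z

record IsFiniteSimpleConnected (G : RawGraph) : Set where
  field
    finite    : Σ ℕ λ n → V G ↔ Fin n
    irrefl    : (x : V G) → ¬ Adj G x x
    symmetric : (x y : V G) → Adj G x y → Adj G y x
    connected : (x y : V G) → Walk G x y

Nontrivial : RawGraph → Set
Nontrivial G = Σ (V G) λ x → Σ (V G) λ y → x ≢ y

Hyp : RawGraph → Set
Hyp G = (S : List (V G)) → Unique S → 2 ≤ length S → length S ≤ 4 →
  Σ (V G) λ x → Σ (V G) λ y → x ∈ S × y ∈ S × x ≢ y ×
    ¬ InIntervalSet G (Minus S x) x × ¬ InIntervalSet G (Minus S y) y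

-- the cycle C_m on vertices 0,…,m-1 (m = suc m')
Cycle : (m' : ℕ) → RawGraph
Cycle m' = record
  { V   = Fin (suc m')
  ; Adj = λ i j → toℕ j ≡ suc (toℕ i) % suc m' ⊎ toℕ i ≡ suc (toℕ j) % suc m' }

_⊠_ : RawGraph → RawGraph → RawGraph
G ⊠ H = record
  { V   = V G × V H
  ; Adj = λ { (g , h) (g' , h') →
        (g ≡ g' × Adj H h h') ⊎ (h ≡ h' × Adj G g g') ⊎ (Adj G g g' × Adj H h h') } }

GeodeticNumberAtLeast : RawGraph → ℕ → Set
GeodeticNumberAtLeast G m = (S : List (V G)) → Unique S → Geodetic G S → m ≤ length S

module Submission where

-- Vertices of H = G ⊠ C_{2k+1} are pairs (x, l) of a column x ∈ V(G) and a layer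
-- l of the cycle.  Call x extreme for a, b if x ∉ I_G[a,b] unless x ∈ {a, b}.
-- 1. Column lemma (ProductGeodesics): if x is extreme for a, b and (x,l) is an
--    inner vertex of I_H[(a,p),(b,q)], then l is an inner vertex of a geodesic
--    of C from p to q.  Indeed, a geodesic of H longer than d_C(p,q) would
--    project onto a geodesic of G, since pairs of walks lift to walks of H of
--    the larger of the two lengths.
-- 2. On C_{2k+1} (CycleArithmetic, CycleGeodesics) this means that l lies
--    strictly inside a forward arc of length ≤ k between p and q.
-- 3. At most four layer positions always leave a free layer (FreeLayer): one
--    inside no such short arc and not occupied twice.
-- 4. If S were geodetic with |S| ≤ 4, the column of every extreme vertex would
--    meet a free layer l inside S.  With one column, any vertex off it is
--    extreme; with two or more, the hypothesis gives two extreme vertices, and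
--    layer l would be occupied twice.  The argument works for every k ≥ 1.

open import Defs
open import Data.Nat using (ℕ; zero; suc; _+_; _*_; _∸_; _%_; _≤_; _<_; _⊔_; _⊓_; z≤n; s≤s; _≟_; _≤?_; _<?_)
open import Data.Nat.Properties
open import Data.Nat.DivMod using (m%n<n; m<n⇒m%n≡m; n%n≡0)
open import Data.Fin using (Fin; zero; toℕ; fromℕ<) renaming (_≟_ to _≟ᶠ_)
open import Data.Fin.Properties using (toℕ<n; toℕ-fromℕ<; toℕ-injective; inj⇒≟)
open import Data.List using (List; []; _∷_; _++_; length; replicate; map; deduplicate)
open import Data.List.Properties using (length-++; length-replicate; length-map; length-deduplicate)
open import Data.List.Sort ≤-decTotalOrder using (sort; sort-↭; sort-↗)
open import Data.List.Relation.Unary.Linked using (Linked; _∷_)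
open import Data.List.Membership.Propositional using (_∈_)
open import Data.List.Membership.Propositional.Properties using (∈-++⁺ˡ; ∈-∃++; ∈-map⁺; ∈-deduplicate⁺)
open import Data.List.Relation.Unary.Any using (here; there)
open import Data.List.Relation.Unary.All as All using (All; []; _∷_)
open import Data.List.Relation.Unary.All.Properties using (replicate⁺) renaming (++⁺ to All-++⁺)
open import Data.List.Relation.Binary.Permutation.Propositional using (_↭_; ↭-sym; ↭-trans; ↭-prep)
open import Data.List.Relation.Binary.Permutation.Propositional.Properties using (∈-resp-↭; drop-∷; ↭-length; ++⁺ʳ; shift) renaming (map⁺ to ↭-map⁺)
open import Data.Product using (Σ; _×_; _,_; proj₁; proj₂)
open import Data.Sum using (_⊎_; inj₁; inj₂) renaming (map to ⊎-map)
open import Data.Empty using (⊥; ⊥-elim)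
open import Data.List.Relation.Unary.Unique.Propositional using (Unique)
open import Data.List.Relation.Unary.Unique.DecPropositional.Properties using (deduplicate-!)
open import Data.Product.Properties using (≡-dec)
open import Function using (_∘_)
open import Function.Properties.Inverse using (↔⇒↣)
open import Relation.Nullary using (¬_; yes; no)
open import Relation.Binary.Definitions using (DecidableEquality)
open import Relation.Binary.PropositionalEquality
open import Data.Nat.Tactic.RingSolver using (solve-∀)

module _ {G : RawGraph} where

  infixr 5 _++ʷ_

  _++ʷ_ : ∀ {a b c} → Walk G a b → Walk G b c → Walk G a c
  [] _    ++ʷ w' = w'
  (e ∷ w) ++ʷ w' = e ∷ (w ++ʷ w')

  length-++ʷ : ∀ {a b c} (w : Walk G a b) (w' : Walk G b c) →
               wlength (w ++ʷ w') ≡ wlength w + wlength w'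
  length-++ʷ ([] _)  w' = refl
  length-++ʷ (e ∷ w) w' = cong suc (length-++ʷ w w')

  visits-start : ∀ {a b} (w : Walk G a b) → Visits w a
  visits-start ([] _)  = refl
  visits-start (e ∷ w) = inj₁ refl

  visits-junction : ∀ {a b c} (w : Walk G a b) (w' : Walk G b c) → Visits (w ++ʷ w') b
  visits-junction ([] _)  w' = visits-start w'
  visits-junction (e ∷ w) w' = inj₂ (visits-junction w w')

  split-at : ∀ {a b z} (w : Walk G a b) → Visits w z →
             Σ (Walk G a z) λ w₁ → Σ (Walk G z b) λ w₂ → wlength w₁ + wlength w₂ ≡ wlength w
  split-at ([] x)  refl        = [] x , [] x , refl
  split-at (e ∷ w) (inj₁ refl) = [] _ , e ∷ w , refl
  split-at (e ∷ w) (inj₂ v) with split-at w v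
  ... | w₁ , w₂ , eq = e ∷ w₁ , w₂ , cong suc eq

  length-zero⇒≡ : ∀ {a b} (w : Walk G a b) → wlength w ≡ 0 → a ≡ b
  length-zero⇒≡ ([] _) _ = refl

  reverse : (∀ {x y} → Adj G x y → Adj G y x) → ∀ {a b} → Walk G a b → Walk G b a
  reverse sym-adj ([] a)  = [] a
  reverse sym-adj (e ∷ w) = reverse sym-adj w ++ʷ (sym-adj e ∷ [] _)

  length-reverse : (sym-adj : ∀ {x y} → Adj G x y → Adj G y x) →
                   ∀ {a b} (w : Walk G a b) → wlength (reverse sym-adj w) ≡ wlength w
  length-reverse sym-adj ([] a)  = refl
  length-reverse sym-adj (e ∷ w) = begin
    wlength (reverse sym-adj w ++ʷ (sym-adj e ∷ [] _))  ≡⟨ length-++ʷ (reverse sym-adj w) _ ⟩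
    wlength (reverse sym-adj w) + 1                      ≡⟨ +-comm _ 1 ⟩
    suc (wlength (reverse sym-adj w))                    ≡⟨ cong suc (length-reverse sym-adj w) ⟩
    suc (wlength w)                                      ∎
    where open ≡-Reasoning

  interval-self : ∀ {a x} → InInterval G a a x → x ≡ a
  interval-self {a} (w , shortest , visits) with shortest ([] a)
  interval-self ([] _ , _ , visits) | _  = visits
  interval-self (_ ∷ _ , _ , _)     | ()

-- Walks in a strong product project to walks in each factor (a step moves each
-- coordinate by at most one edge), and pairs of walks combine into a product walk
-- whose length is the larger of the two lengths (diagonal steps).

module StrongProduct (G C : RawGraph) where

  H : RawGraph
  H = G ⊠ C

  project₁ : ∀ {u v} → Walk H u v → Walk G (proj₁ u) (proj₁ v)
  project₁ ([] _)                     = [] _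
  project₁ (inj₁ (refl , _) ∷ w)      = project₁ w
  project₁ (inj₂ (inj₁ (_ , e)) ∷ w)  = e ∷ project₁ w
  project₁ (inj₂ (inj₂ (e , _)) ∷ w)  = e ∷ project₁ w

  length-project₁ : ∀ {u v} (w : Walk H u v) → wlength (project₁ w) ≤ wlength w
  length-project₁ ([] _)                     = z≤n
  length-project₁ (inj₁ (refl , _) ∷ w)      = m≤n⇒m≤1+n (length-project₁ w)
  length-project₁ (inj₂ (inj₁ (_ , e)) ∷ w)  = s≤s (length-project₁ w)
  length-project₁ (inj₂ (inj₂ (e , _)) ∷ w)  = s≤s (length-project₁ w)

  project₂ : ∀ {u v} → Walk H u v → Walk C (proj₂ u) (proj₂ v)
  project₂ ([] _)                     = [] _
  project₂ (inj₁ (_ , e) ∷ w)         = e ∷ project₂ w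
  project₂ (inj₂ (inj₁ (refl , _)) ∷ w) = project₂ w
  project₂ (inj₂ (inj₂ (_ , e)) ∷ w)  = e ∷ project₂ w

  length-project₂ : ∀ {u v} (w : Walk H u v) → wlength (project₂ w) ≤ wlength w
  length-project₂ ([] _)                     = z≤n
  length-project₂ (inj₁ (_ , e) ∷ w)         = s≤s (length-project₂ w)
  length-project₂ (inj₂ (inj₁ (refl , _)) ∷ w) = m≤n⇒m≤1+n (length-project₂ w)
  length-project₂ (inj₂ (inj₂ (_ , e)) ∷ w)  = s≤s (length-project₂ w)

  pair : ∀ {g h i j} → Walk G g h → Walk C i j → Walk H (g , i) (h , j)
  pair ([] g)  ([] i)  = [] (g , i)
  pair ([] g)  (e ∷ c) = inj₁ (refl , e) ∷ pair ([] g) c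
  pair (e ∷ w) ([] i)  = inj₂ (inj₁ (refl , e)) ∷ pair w ([] i)
  pair (e ∷ w) (f ∷ c) = inj₂ (inj₂ (e , f)) ∷ pair w c

  length-pair : ∀ {g h i j} (w : Walk G g h) (c : Walk C i j) →
                wlength (pair w c) ≡ wlength w ⊔ wlength c
  length-pair ([] g)  ([] i)  = refl
  length-pair ([] g)  (f ∷ c) = cong suc (length-pair ([] g) c)
  length-pair (e ∷ w) ([] i)  = cong suc (trans (length-pair w ([] i)) (⊔-identityʳ _))
  length-pair (e ∷ w) (f ∷ c) = cong suc (length-pair w c)

≤⊔-drop : ∀ x a b → x ≤ a ⊔ b → b < x → x ≤ a
≤⊔-drop x a b le b<x with ≤-total a b
... | inj₁ a≤b = ⊥-elim (<⇒≱ b<x (subst (x ≤_) (m≤n⇒m⊔n≡n a≤b) le))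
... | inj₂ b≤a = subst (x ≤_) (m≥n⇒m⊔n≡m b≤a) le

m+n≤n⇒m≡0 : ∀ m n → m + n ≤ n → m ≡ 0
m+n≤n⇒m≡0 m n le = n≤0⇒n≡0 (+-cancelʳ-≤ n m 0 le)

Extreme : (G : RawGraph) → V G → V G → V G → Set
Extreme G a b x = a ≢ x → b ≢ x → ¬ InInterval G a b x

module ProductGeodesics (G C : RawGraph) (d : V C → V C → ℕ)
  (d-lower    : ∀ {p q} (c : Walk C p q) → d p q ≤ wlength c)
  (d-attained : ∀ p q → Σ (Walk C p q) λ c → wlength c ≤ d p q) where

  open StrongProduct G C

  d-self : ∀ p → d p p ≡ 0
  d-self p = n≤0⇒n≡0 (d-lower ([] p))

  d-triangle : ∀ p l q → d p q ≤ d p l + d l q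
  d-triangle p l q with d-attained p l | d-attained l q
  ... | c₁ , le₁ | c₂ , le₂ = begin
    d p q                     ≤⟨ d-lower (c₁ ++ʷ c₂) ⟩
    wlength (c₁ ++ʷ c₂)       ≡⟨ length-++ʷ c₁ c₂ ⟩
    wlength c₁ + wlength c₂   ≤⟨ +-mono-≤ le₁ le₂ ⟩
    d p l + d l q             ∎
    where open ≤-Reasoning

  lift : ∀ {a b} (g : Walk G a b) p q →
         Σ (Walk H (a , p) (b , q)) λ w → wlength w ≤ wlength g ⊔ d p q
  lift g p q with d-attained p q
  ... | c , le = pair g c , ≤-trans (≤-reflexive (length-pair g c)) (⊔-monoʳ-≤ (wlength g) le)

  long-geodesic-bound : ∀ {a b p q} (w : Walk H (a , p) (b , q)) → Shortest w →
                        d p q < wlength w → (g : Walk G a b) → wlength w ≤ wlength g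
  long-geodesic-bound {p = p} {q} w shortest long g with lift g p q
  ... | w' , le = ≤⊔-drop (wlength w) (wlength g) (d p q) (≤-trans (shortest w') le) long

  long-geodesic-start : ∀ {a b p q l} (w : Walk H (a , p) (b , q)) → Shortest w →
    d p q < wlength w → (w₁ : Walk H (a , p) (a , l)) (w₂ : Walk H (a , l) (b , q)) →
    wlength w₁ + wlength w₂ ≡ wlength w → (a , p) ≡ (a , l)
  long-geodesic-start w shortest long w₁ w₂ eq =
    length-zero⇒≡ w₁ (m+n≤n⇒m≡0 (wlength w₁) (wlength w₂) (begin
      wlength w₁ + wlength w₂  ≡⟨ eq ⟩
      wlength w                ≤⟨ long-geodesic-bound w shortest long (project₁ w₂) ⟩
      wlength (project₁ w₂)    ≤⟨ length-project₁ w₂ ⟩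
      wlength w₂               ∎))
    where open ≤-Reasoning

  long-geodesic-end : ∀ {a b p q l} (w : Walk H (a , p) (b , q)) → Shortest w →
    d p q < wlength w → (w₁ : Walk H (a , p) (b , l)) (w₂ : Walk H (b , l) (b , q)) →
    wlength w₁ + wlength w₂ ≡ wlength w → (b , l) ≡ (b , q)
  long-geodesic-end w shortest long w₁ w₂ eq =
    length-zero⇒≡ w₂ (m+n≤n⇒m≡0 (wlength w₂) (wlength w₁) (begin
      wlength w₂ + wlength w₁  ≡⟨ +-comm (wlength w₂) (wlength w₁) ⟩
      wlength w₁ + wlength w₂  ≡⟨ eq ⟩
      wlength w                ≤⟨ long-geodesic-bound w shortest long (project₁ w₁) ⟩
      wlength (project₁ w₁)    ≤⟨ length-project₁ w₁ ⟩
      wlength w₁               ∎))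
    where open ≤-Reasoning

  -- Through a vertex (x,l) of H whose first coordinate is extreme for a, b and
  -- which is not an end, every geodesic from (a,p) to (b,q) has length ≤ d(p,q):
  -- otherwise its G-projection would be a geodesic of G through x.
  geodesic-through-extreme : DecidableEquality (V G) →
    ∀ {a b x p q l} → Extreme G a b x →
    (w : Walk H (a , p) (b , q)) → Shortest w →
    (w₁ : Walk H (a , p) (x , l)) (w₂ : Walk H (x , l) (b , q)) →
    wlength w₁ + wlength w₂ ≡ wlength w →
    (x , l) ≢ (a , p) → (x , l) ≢ (b , q) → wlength w ≤ d p q
  geodesic-through-extreme _≟ᴳ_ {a} {b} {x} {p} {q} ext w shortest w₁ w₂ eq not-start not-end
    with wlength w ≤? d p q | a ≟ᴳ x | b ≟ᴳ x
  ... | yes short | _        | _        = short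
  ... | no long   | yes refl | _        =
    ⊥-elim (not-start (sym (long-geodesic-start w shortest (≰⇒> long) w₁ w₂ eq)))
  ... | no long   | no _     | yes refl =
    ⊥-elim (not-end (long-geodesic-end w shortest (≰⇒> long) w₁ w₂ eq))
  ... | no long   | no a≢x   | no b≢x   =
    ⊥-elim (ext a≢x b≢x (g₁ ++ʷ g₂ , geodesic , visits-junction g₁ g₂))
    where
    open ≤-Reasoning
    g₁ : Walk G a x
    g₁ = project₁ w₁
    g₂ : Walk G x b
    g₂ = project₁ w₂
    geodesic : Shortest (g₁ ++ʷ g₂)
    geodesic g = begin
      wlength (g₁ ++ʷ g₂)                     ≡⟨ length-++ʷ g₁ g₂ ⟩
      wlength g₁ + wlength g₂                 ≤⟨ +-mono-≤ (length-project₁ w₁) (length-project₁ w₂) ⟩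
      wlength w₁ + wlength w₂                 ≡⟨ eq ⟩
      wlength w                               ≤⟨ long-geodesic-bound w shortest (≰⇒> long) g ⟩
      wlength g                               ∎

  extreme-column : DecidableEquality (V G) → ∀ {a b x p q l} → Extreme G a b x →
    InInterval H (a , p) (b , q) (x , l) → (x , l) ≢ (a , p) → (x , l) ≢ (b , q) →
    l ≢ p × l ≢ q × d p l + d l q ≤ d p q
  extreme-column _≟ᴳ_ {p = p} {q} {l} ext (w , shortest , visits) not-start not-end
    with split-at w visits
  ... | w₁ , w₂ , eq = l≢p , l≢q , between
    where
    open ≤-Reasoning

    short : wlength w ≤ d p q
    short = geodesic-through-extreme _≟ᴳ_ ext w shortest w₁ w₂ eq not-start not-end

    d₁ : d p l ≤ wlength w₁
    d₁ = ≤-trans (d-lower (project₂ w₁)) (length-project₂ w₁)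
    d₂ : d l q ≤ wlength w₂
    d₂ = ≤-trans (d-lower (project₂ w₂)) (length-project₂ w₂)

    between : d p l + d l q ≤ d p q
    between = begin
      d p l + d l q            ≤⟨ +-mono-≤ d₁ d₂ ⟩
      wlength w₁ + wlength w₂  ≡⟨ eq ⟩
      wlength w                ≤⟨ short ⟩
      d p q                    ∎

    tight : wlength w₁ + wlength w₂ ≤ d p l + d l q
    tight = begin
      wlength w₁ + wlength w₂  ≡⟨ eq ⟩
      wlength w                ≤⟨ short ⟩
      d p q                    ≤⟨ d-triangle p l q ⟩
      d p l + d l q            ∎

    l≢p : l ≢ p
    l≢p l≡p = not-start (sym (length-zero⇒≡ w₁ (m+n≤n⇒m≡0 (wlength w₁) (wlength w₂) (begin
      wlength w₁ + wlength w₂  ≤⟨ tight ⟩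
      d p l + d l q            ≡⟨ cong (_+ d l q) (trans (cong (d p) l≡p) (d-self p)) ⟩
      d l q                    ≤⟨ d₂ ⟩
      wlength w₂               ∎))))

    l≢q : l ≢ q
    l≢q l≡q = not-end (length-zero⇒≡ w₂ (m+n≤n⇒m≡0 (wlength w₂) (wlength w₁) (begin
      wlength w₂ + wlength w₁  ≡⟨ +-comm (wlength w₂) (wlength w₁) ⟩
      wlength w₁ + wlength w₂  ≤⟨ tight ⟩
      d p l + d l q            ≡⟨ cong (d p l +_) (trans (cong (d l) (sym l≡q)) (d-self l)) ⟩
      d p l + 0                ≡⟨ +-identityʳ (d p l) ⟩
      d p l                    ≤⟨ d₁ ⟩
      wlength w₁               ∎)))

-- Arithmetic of ℤ/N for N = n + 1, on representatives 0 ≤ a < N.  The forward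
-- distance fwd a b is the number of steps from a to b in the positive direction;
-- the distance of the cycle C_N is dist a b = min(fwd a b, fwd b a).

module CycleArithmetic (n : ℕ) where

  N : ℕ
  N = suc n

  fwd : ℕ → ℕ → ℕ
  fwd a b with a ≤? b
  ... | yes _ = b ∸ a
  ... | no _  = N + b ∸ a

  Offset : ℕ → ℕ → ℕ → Set
  Offset a b d = a + d ≡ b ⊎ a + d ≡ b + N

  fwd-offset : ∀ a b → a < N → Offset a b (fwd a b)
  fwd-offset a b a<N with a ≤? b
  ... | yes a≤b = inj₁ (m+[n∸m]≡n a≤b)
  ... | no _    = inj₂ (trans (m+[n∸m]≡n (≤-trans (<⇒≤ a<N) (m≤m+n N b))) (+-comm N b))

  fwd-≤ : ∀ {a b} → a ≤ b → fwd a b ≡ b ∸ a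
  fwd-≤ {a} {b} a≤b with a ≤? b
  ... | yes _   = refl
  ... | no a≰b  = ⊥-elim (a≰b a≤b)

  fwd-> : ∀ {a b} → b < a → fwd a b ≡ N + b ∸ a
  fwd-> {a} {b} b<a with a ≤? b
  ... | yes a≤b = ⊥-elim (<⇒≱ b<a a≤b)
  ... | no _    = refl

  fwd<N : ∀ a b → a < N → b < N → fwd a b < N
  fwd<N a b a<N b<N with a ≤? b
  ... | yes _   = ≤-<-trans (m∸n≤m b a) b<N
  ... | no a≰b  = +-cancelˡ-< a (N + b ∸ a) N (begin-strict
    a + (N + b ∸ a)  ≡⟨ m+[n∸m]≡n (≤-trans (<⇒≤ a<N) (m≤m+n N b)) ⟩
    N + b            ≡⟨ +-comm N b ⟩
    b + N            <⟨ +-monoˡ-< N (≰⇒> a≰b) ⟩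
    a + N            ∎)
    where open ≤-Reasoning

  offset-unique : ∀ {a b d d'} → d < N → d' < N → Offset a b d → Offset a b d' → d ≡ d'
  offset-unique {a} _ _ (inj₁ e) (inj₁ e') = +-cancelˡ-≡ a _ _ (trans e (sym e'))
  offset-unique {a} _ _ (inj₂ e) (inj₂ e') = +-cancelˡ-≡ a _ _ (trans e (sym e'))
  offset-unique {a} {b} {d} {d'} _ d'<N (inj₁ e) (inj₂ e') =
    ⊥-elim (m+n≮n d N (subst (_< N) (+-cancelˡ-≡ a d' (d + N)
      (trans e' (trans (cong (_+ N) (sym e)) (+-assoc a d N)))) d'<N))
  offset-unique {a} {b} {d} {d'} d<N _ (inj₂ e) (inj₁ e') =
    ⊥-elim (m+n≮n d' N (subst (_< N) (+-cancelˡ-≡ a d (d' + N)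
      (trans e (trans (cong (_+ N) (sym e')) (+-assoc a d' N)))) d<N))

  private
    continue : ∀ a x {b} y → a + x ≡ b → a + (x + y) ≡ b + y
    continue a x y e = trans (sym (+-assoc a x y)) (cong (_+ y) e)

    wrap : ∀ b y → (b + N) + y ≡ (b + y) + N
    wrap b y = trans (+-assoc b N y) (trans (cong (b +_) (+-comm N y)) (sym (+-assoc b y N)))

  offset-compose : ∀ a b c x y → Offset a b x → Offset b c y →
                   Offset a c (x + y) ⊎ a + (x + y) ≡ (c + N) + N
  offset-compose a b c x y (inj₁ e) (inj₁ f) = inj₁ (inj₁ (trans (continue a x y e) f))
  offset-compose a b c x y (inj₁ e) (inj₂ f) = inj₁ (inj₂ (trans (continue a x y e) f))
  offset-compose a b c x y (inj₂ e) (inj₁ f) =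
    inj₁ (inj₂ (trans (continue a x y e) (trans (wrap b y) (cong (_+ N) f))))
  offset-compose a b c x y (inj₂ e) (inj₂ f) =
    inj₂ (trans (continue a x y e) (trans (wrap b y) (cong (_+ N) f)))

  fwd-add : ∀ a b c → a < N → b < N → c < N →
            fwd a b + fwd b c ≡ fwd a c ⊎ fwd a b + fwd b c ≡ fwd a c + N
  fwd-add a b c a<N b<N c<N with fwd a b + fwd b c <? N
  ... | yes s<N = inj₁ (offset-unique s<N (fwd<N a c a<N c<N) offset-s (fwd-offset a c a<N))
    where
    s : ℕ
    s = fwd a b + fwd b c
    offset-s : Offset a c s
    offset-s with offset-compose a b c (fwd a b) (fwd b c) (fwd-offset a b a<N) (fwd-offset b c b<N)
    ... | inj₁ o = o
    ... | inj₂ e = ⊥-elim (<-irrefl e (begin-strict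
      a + s        <⟨ +-mono-< a<N s<N ⟩
      N + N        ≤⟨ +-monoˡ-≤ N (m≤n+m N c) ⟩
      (c + N) + N  ∎))
      where open ≤-Reasoning
  ... | no s≮N = inj₂ (trans (sym t+N≡s)
                   (cong (_+ N) (offset-unique t<N (fwd<N a c a<N c<N) offset-t (fwd-offset a c a<N))))
    where
    s t : ℕ
    s = fwd a b + fwd b c
    t = s ∸ N
    t+N≡s : t + N ≡ s
    t+N≡s = m∸n+n≡m (≮⇒≥ s≮N)
    t<N : t < N
    t<N = +-cancelʳ-< N t N (subst (_< N + N) (sym t+N≡s)
            (+-mono-< (fwd<N a b a<N b<N) (fwd<N b c b<N c<N)))
    unwrap : ∀ {m} → a + s ≡ m + N → a + t ≡ m
    unwrap {m} e = +-cancelʳ-≡ N _ _ (trans (+-assoc a t N) (trans (cong (a +_) t+N≡s) e))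
    offset-t : Offset a c t
    offset-t with offset-compose a b c (fwd a b) (fwd b c) (fwd-offset a b a<N) (fwd-offset b c b<N)
    ... | inj₁ (inj₁ e) = ⊥-elim (<⇒≱ c<N (subst (N ≤_) e (≤-trans (≮⇒≥ s≮N) (m≤n+m s a))))
    ... | inj₁ (inj₂ e) = inj₁ (unwrap e)
    ... | inj₂ e        = inj₂ (unwrap e)

  fwd-self : ∀ a → fwd a a ≡ 0
  fwd-self a with a ≤? a
  ... | yes _   = n∸n≡0 a
  ... | no a≰a  = ⊥-elim (a≰a ≤-refl)

  fwd-zero⇒≡ : ∀ {a b} → a < N → fwd a b ≡ 0 → a ≡ b
  fwd-zero⇒≡ {a} {b} a<N e with fwd-offset a b a<N
  ... | inj₁ o = trans (sym (+-identityʳ a)) (trans (cong (a +_) (sym e)) o)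
  ... | inj₂ o = ⊥-elim (<⇒≱ a<N (subst (N ≤_)
                   (sym (trans (sym (+-identityʳ a)) (trans (cong (a +_) (sym e)) o))) (m≤n+m N b)))

  fwd-triangle : ∀ a b c → a < N → b < N → c < N → fwd a c ≤ fwd a b + fwd b c
  fwd-triangle a b c a<N b<N c<N with fwd-add a b c a<N b<N c<N
  ... | inj₁ e = ≤-reflexive (sym e)
  ... | inj₂ e = subst (fwd a c ≤_) (sym e) (m≤m+n (fwd a c) N)

  fwd-turn : ∀ a b → a < N → b < N → a ≢ b → fwd a b + fwd b a ≡ N
  fwd-turn a b a<N b<N a≢b with fwd-add a b a a<N b<N a<N
  ... | inj₁ e = ⊥-elim (a≢b (fwd-zero⇒≡ a<N (m+n≡0⇒m≡0 (fwd a b) (trans e (fwd-self a)))))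
  ... | inj₂ e = trans e (cong (_+ N) (fwd-self a))

  dist : ℕ → ℕ → ℕ
  dist a b = fwd a b ⊓ fwd b a

  dist-step⁺ : ∀ u v q → u < N → v < N → q < N → fwd u v ≡ 1 → dist u q ≤ suc (dist v q)
  dist-step⁺ u v q u<N v<N q<N uv = ⊓-glb via-fwd via-bwd
    where
    via-fwd : dist u q ≤ suc (fwd v q)
    via-fwd = ≤-trans (m⊓n≤m _ _)
                (subst (λ s → fwd u q ≤ s + fwd v q) uv (fwd-triangle u v q u<N v<N q<N))
    via-bwd : dist u q ≤ suc (fwd q v)
    via-bwd with fwd-add q u v q<N u<N v<N
    ... | inj₁ e = ≤-trans (m⊓n≤n _ _) (begin
      fwd q u          ≤⟨ m≤m+n (fwd q u) 1 ⟩
      fwd q u + 1      ≡⟨ trans (cong (fwd q u +_) (sym uv)) e ⟩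
      fwd q v          ≤⟨ n≤1+n _ ⟩
      suc (fwd q v)    ∎)
      where open ≤-Reasoning
    ... | inj₂ e = ≤-trans (m⊓n≤m _ _) (≤-trans (≤-reflexive (trans (cong (fwd u) q≡v) uv)) (s≤s z≤n))
      where
      -- the sum fwd q u + fwd u v stays within one turn, so wrapping means q = v
      within : fwd q u + fwd u v ≤ N
      within = subst (_≤ N) (trans (+-comm 1 _) (cong (fwd q u +_) (sym uv))) (fwd<N q u q<N u<N)
      q≡v : q ≡ v
      q≡v = fwd-zero⇒≡ q<N (n≤0⇒n≡0 (+-cancelʳ-≤ N _ 0 (subst (_≤ N) e within)))

  dist-step⁻ : ∀ u v q → u < N → v < N → q < N → fwd u v ≡ 1 → dist v q ≤ suc (dist u q)
  dist-step⁻ u v q u<N v<N q<N uv = ⊓-glb via-fwd via-bwd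
    where
    via-bwd : dist v q ≤ suc (fwd q u)
    via-bwd = ≤-trans (m⊓n≤n _ _)
                (subst (fwd q v ≤_) (trans (cong (fwd q u +_) uv) (+-comm _ 1)) (fwd-triangle q u v q<N u<N v<N))
    via-fwd : dist v q ≤ suc (fwd u q)
    via-fwd with fwd-add u v q u<N v<N q<N
    ... | inj₁ e = ≤-trans (m⊓n≤m _ _) (begin
      fwd v q          ≤⟨ n≤1+n _ ⟩
      1 + fwd v q      ≡⟨ trans (cong (_+ fwd v q) (sym uv)) e ⟩
      fwd u q          ≤⟨ n≤1+n _ ⟩
      suc (fwd u q)    ∎)
      where open ≤-Reasoning
    ... | inj₂ e = ≤-trans (m⊓n≤n _ _) (≤-trans (≤-reflexive (trans (cong (λ s → fwd s v) q≡u) uv)) (s≤s z≤n))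
      where
      -- the sum fwd u v + fwd v q stays within one turn, so wrapping means q = u
      within : fwd u v + fwd v q ≤ N
      within = subst (_≤ N) (cong (_+ fwd v q) (sym uv)) (fwd<N v q v<N q<N)
      q≡u : q ≡ u
      q≡u = sym (fwd-zero⇒≡ u<N (n≤0⇒n≡0 (+-cancelʳ-≤ N _ 0 (subst (_≤ N) e within))))

  dist-zero⇒≡ : ∀ {a b} → a < N → b < N → dist a b ≡ 0 → a ≡ b
  dist-zero⇒≡ {a} {b} a<N b<N e with ≤-total (fwd a b) (fwd b a)
  ... | inj₁ le = fwd-zero⇒≡ a<N (trans (sym (m≤n⇒m⊓n≡m le)) e)
  ... | inj₂ ge = sym (fwd-zero⇒≡ b<N (trans (sym (m≥n⇒m⊓n≡n ge)) e))

  private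
    -- Arithmetic core of the mixed case below: with A + B ≡ F (mod N), B + B' ≡ N
    -- and F + F' ≡ N, the sum A + B' fits under both F and F' only if A or B'
    -- vanishes.
    mixed-arcs : ∀ A B B' F F' → (A + B ≡ F ⊎ A + B ≡ F + N) → B + B' ≡ N → F + F' ≡ N →
                 A + B' ≤ F → A + B' ≤ F' → A ≡ 0 ⊎ B' ≡ 0
    mixed-arcs A B B' F F' (inj₁ e) bb ff _ le = inj₁ (n≤0⇒n≡0 (m+n≤o⇒m≤o A (+-cancelʳ-≤ F' (A + A) 0
      (subst (_≤ F') (trans (cong (A +_) (sym B'≡A+F')) (sym (+-assoc A A F'))) le))))
      where
      B'≡A+F' : A + F' ≡ B'
      B'≡A+F' = +-cancelˡ-≡ B _ _ (begin
        B + (A + F')  ≡⟨ sym (+-assoc B A F') ⟩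
        (B + A) + F'  ≡⟨ cong (_+ F') (trans (+-comm B A) e) ⟩
        F + F'        ≡⟨ trans ff (sym bb) ⟩
        B + B'        ∎)
        where open ≡-Reasoning
    mixed-arcs A B B' F F' (inj₂ e) bb ff le _ = inj₂ (n≤0⇒n≡0 (m+n≤o⇒m≤o B' (+-cancelˡ-≤ F (B' + B') 0
      (subst₂ _≤_ (trans (cong (_+ B') A≡F+B') (+-assoc F B' B')) (sym (+-identityʳ F)) le))))
      where
      A≡F+B' : A ≡ F + B'
      A≡F+B' = +-cancelˡ-≡ B _ _ (begin
        B + A         ≡⟨ trans (+-comm B A) e ⟩
        F + N         ≡⟨ cong (F +_) (sym bb) ⟩
        F + (B + B')  ≡⟨ sym (+-assoc F B B') ⟩
        (F + B) + B'  ≡⟨ cong (_+ B') (+-comm F B) ⟩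
        (B + F) + B'  ≡⟨ +-assoc B F B' ⟩
        B + (F + B')  ∎)
        where open ≡-Reasoning

  between⇒arc : ∀ p l q → p < N → l < N → q < N → l ≢ p → l ≢ q →
    dist p l + dist l q ≤ dist p q →
    fwd p l + fwd l q ≤ dist p q ⊎ fwd q l + fwd l p ≤ dist p q
  between⇒arc p l q p<N l<N q<N l≢p l≢q between with p ≟ q
  ... | yes refl = ⊥-elim (l≢p (sym (dist-zero⇒≡ p<N l<N (n≤0⇒n≡0 (begin
    dist p l                 ≤⟨ m≤m+n _ _ ⟩
    dist p l + dist l p      ≤⟨ between ⟩
    dist p p                 ≤⟨ m⊓n≤m _ _ ⟩
    fwd p p                  ≡⟨ fwd-self p ⟩
    0                        ∎)))))
    where open ≤-Reasoning
  ... | no p≢q = by-direction (≤-total A A') (≤-total B B')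
    where
    A A' B B' F F' : ℕ
    A = fwd p l
    A' = fwd l p
    B = fwd l q
    B' = fwd q l
    F = fwd p q
    F' = fwd q p
    add : A + B ≡ F ⊎ A + B ≡ F + N
    add = fwd-add p l q p<N l<N q<N
    le-F : ∀ {s} → s ≤ dist p q → s ≤ F
    le-F s≤ = ≤-trans s≤ (m⊓n≤m F F')
    le-F' : ∀ {s} → s ≤ dist p q → s ≤ F'
    le-F' s≤ = ≤-trans s≤ (m⊓n≤n F F')

    by-direction : A ≤ A' ⊎ A' ≤ A → B ≤ B' ⊎ B' ≤ B →
                   A + B ≤ dist p q ⊎ B' + A' ≤ dist p q
    by-direction (inj₁ a) (inj₁ b) =
      inj₁ (subst₂ (λ x y → x + y ≤ dist p q) (m≤n⇒m⊓n≡m a) (m≤n⇒m⊓n≡m b) between)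
    by-direction (inj₂ a) (inj₂ b) =
      inj₂ (subst (_≤ dist p q) (+-comm A' B')
        (subst₂ (λ x y → x + y ≤ dist p q) (m≥n⇒m⊓n≡n a) (m≥n⇒m⊓n≡n b) between))
    by-direction (inj₁ a) (inj₂ b)
      with mixed-arcs A B B' F F' add (fwd-turn l q l<N q<N l≢q) (fwd-turn p q p<N q<N p≢q)
             (le-F short) (le-F' short)
      where
      short : A + B' ≤ dist p q
      short = subst₂ (λ x y → x + y ≤ dist p q) (m≤n⇒m⊓n≡m a) (m≥n⇒m⊓n≡n b) between
    ... | inj₁ A≡0  = ⊥-elim (l≢p (sym (fwd-zero⇒≡ p<N A≡0)))
    ... | inj₂ B'≡0 = ⊥-elim (l≢q (sym (fwd-zero⇒≡ q<N B'≡0)))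
    by-direction (inj₂ a) (inj₁ b)
      with mixed-arcs B A A' F F' (⊎-map (trans (+-comm B A)) (trans (+-comm B A)) add)
             (fwd-turn p l p<N l<N (λ e → l≢p (sym e))) (fwd-turn p q p<N q<N p≢q) (le-F short) (le-F' short)
      where
      short : B + A' ≤ dist p q
      short = subst (_≤ dist p q) (+-comm A' B)
                (subst₂ (λ x y → x + y ≤ dist p q) (m≥n⇒m⊓n≡n a) (m≤n⇒m⊓n≡m b) between)
    ... | inj₁ B≡0  = ⊥-elim (l≢q (fwd-zero⇒≡ l<N B≡0))
    ... | inj₂ A'≡0 = ⊥-elim (l≢p (fwd-zero⇒≡ l<N A'≡0))

-- The cycle C_N (N = n + 1 ≥ 2) has the exact metric dist on the values of its
-- vertices: every walk is at least that long (each step changes dist by at most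
-- one) and walking forward or backward attains it.

module CycleGeodesics (n : ℕ) (n≥1 : 1 ≤ n) where

  open CycleArithmetic n public

  C : RawGraph
  C = Cycle n

  d : Fin N → Fin N → ℕ
  d i j = dist (toℕ i) (toℕ j)

  fwd-successor : ∀ i j → i < N → j ≡ suc i % N → fwd i j ≡ 1
  fwd-successor i j i<N e = offset-unique (fwd<N i j i<N j<N) (s≤s n≥1) (fwd-offset i j i<N) one-step
    where
    j<N : j < N
    j<N = subst (_< N) (sym e) (m%n<n (suc i) N)
    one-step : Offset i j 1
    one-step with suc i <? N
    ... | yes i+1<N = inj₁ (trans (+-comm i 1) (sym (trans e (m<n⇒m%n≡m i+1<N))))
    ... | no i+1≮N  = inj₂ (trans (+-comm i 1) (trans i+1≡N (cong (_+ N) (sym j≡0))))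
      where
      i+1≡N : suc i ≡ N
      i+1≡N = ≤-antisym i<N (≮⇒≥ i+1≮N)
      j≡0 : j ≡ 0
      j≡0 = trans e (trans (cong (_% N) i+1≡N) (n%n≡0 N))

  adjacent⇒step : ∀ {i j} → Adj C i j → fwd (toℕ i) (toℕ j) ≡ 1 ⊎ fwd (toℕ j) (toℕ i) ≡ 1
  adjacent⇒step {i} {j} (inj₁ e) = inj₁ (fwd-successor (toℕ i) (toℕ j) (toℕ<n i) e)
  adjacent⇒step {i} {j} (inj₂ e) = inj₂ (fwd-successor (toℕ j) (toℕ i) (toℕ<n j) e)

  d-lower : ∀ {p q} (w : Walk C p q) → d p q ≤ wlength w
  d-lower ([] p) = ≤-trans (m⊓n≤m _ _) (≤-reflexive (fwd-self (toℕ p)))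
  d-lower {p} {q} (_∷_ {y = p'} e w) with adjacent⇒step e
  ... | inj₁ f = ≤-trans (dist-step⁺ (toℕ p) (toℕ p') (toℕ q) (toℕ<n p) (toℕ<n p') (toℕ<n q) f)
                         (s≤s (d-lower w))
  ... | inj₂ f = ≤-trans (dist-step⁻ (toℕ p') (toℕ p) (toℕ q) (toℕ<n p') (toℕ<n p) (toℕ<n q) f)
                         (s≤s (d-lower w))

  next : Fin N → Fin N
  next p = fromℕ< (m%n<n (suc (toℕ p)) N)

  adjacent-next : ∀ p → Adj C p (next p)
  adjacent-next p = inj₁ (toℕ-fromℕ< (m%n<n (suc (toℕ p)) N))

  forward-walk : ∀ m (p q : Fin N) → fwd (toℕ p) (toℕ q) ≡ m → Σ (Walk C p q) λ w → wlength w ≡ m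
  forward-walk zero p q e =
    subst (λ r → Σ (Walk C p r) λ w → wlength w ≡ 0) (toℕ-injective (fwd-zero⇒≡ (toℕ<n p) e)) ([] p , refl)
  forward-walk (suc m) p q e with forward-walk m (next p) q rest
    where
    p⁺ : Fin N
    p⁺ = next p
    step : fwd (toℕ p) (toℕ p⁺) ≡ 1
    step = fwd-successor (toℕ p) (toℕ p⁺) (toℕ<n p) (toℕ-fromℕ< _)
    rest : fwd (toℕ p⁺) (toℕ q) ≡ m
    rest with fwd-add (toℕ p) (toℕ p⁺) (toℕ q) (toℕ<n p) (toℕ<n p⁺) (toℕ<n q)
    ... | inj₁ f = suc-injective (trans (cong (_+ fwd (toℕ p⁺) (toℕ q)) (sym step)) (trans f e))
    ... | inj₂ f = ⊥-elim (<⇒≱ (fwd<N (toℕ p⁺) (toℕ q) (toℕ<n p⁺) (toℕ<n q))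
                     (subst (N ≤_) (sym wrapped) (m≤n+m N m)))
      where
      wrapped : fwd (toℕ p⁺) (toℕ q) ≡ m + N
      wrapped = suc-injective (trans (cong (_+ fwd (toℕ p⁺) (toℕ q)) (sym step)) (trans f (cong (_+ N) e)))
  ... | w , len = adjacent-next p ∷ w , cong suc len

  symmetric : ∀ {i j} → Adj C i j → Adj C j i
  symmetric (inj₁ e) = inj₂ e
  symmetric (inj₂ e) = inj₁ e

  d-attained : ∀ p q → Σ (Walk C p q) λ w → wlength w ≤ d p q
  d-attained p q with ≤-total (fwd (toℕ p) (toℕ q)) (fwd (toℕ q) (toℕ p))
  ... | inj₁ le with forward-walk _ p q refl
  ...   | w , len = w , ≤-reflexive (trans len (sym (m≤n⇒m⊓n≡m le)))
  d-attained p q | inj₂ ge with forward-walk _ q p refl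
  ...   | w , len = reverse symmetric w ,
                    ≤-reflexive (trans (length-reverse symmetric w) (trans len (sym (m≥n⇒m⊓n≡n ge))))

∸-split : ∀ {u l v} → u ≤ l → l ≤ v → (l ∸ u) + (v ∸ l) ≡ v ∸ u
∸-split {u} {l} {v} u≤l l≤v = +-cancelˡ-≡ u _ _ (begin
  u + ((l ∸ u) + (v ∸ l))  ≡⟨ sym (+-assoc u (l ∸ u) (v ∸ l)) ⟩
  (u + (l ∸ u)) + (v ∸ l)  ≡⟨ cong (_+ (v ∸ l)) (m+[n∸m]≡n u≤l) ⟩
  l + (v ∸ l)              ≡⟨ m+[n∸m]≡n l≤v ⟩
  v                        ≡⟨ sym (m+[n∸m]≡n (≤-trans u≤l l≤v)) ⟩
  u + (v ∸ u)              ∎)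
  where open ≡-Reasoning

-- Positions on C_N with N = 2k + 1 are naturals below N.

module FreeLayer (k : ℕ) (k≥1 : 1 ≤ k) where

  open CycleArithmetic (2 * k)

  Covered : List ℕ → ℕ → Set
  Covered T l = Σ ℕ λ p → Σ ℕ λ q → p ∈ T × q ∈ T × p ≢ l × q ≢ l × fwd p l + fwd l q ≤ k

  Repeated : ℕ → List ℕ → Set
  Repeated l T = Σ (List ℕ) λ T' → T ↭ l ∷ l ∷ T'

  Free : List ℕ → ℕ → Set
  Free T l = l < N × ¬ Covered T l × ¬ Repeated l T

  dist≤k : ∀ a b → a < N → b < N → dist a b ≤ k
  dist≤k a b a<N b<N with a ≟ b | fwd a b ≤? k | fwd b a ≤? k
  ... | yes refl | _      | _      = ≤-trans (m⊓n≤m _ _) (subst (_≤ k) (sym (fwd-self a)) z≤n)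
  ... | no _     | yes ab | _      = ≤-trans (m⊓n≤m _ _) ab
  ... | no _     | no _   | yes ba = ≤-trans (m⊓n≤n _ _) ba
  ... | no a≢b   | no ab  | no ba  = ⊥-elim (<-irrefl refl (begin-strict
    N                    <⟨ n<1+n N ⟩
    suc N                ≡⟨ twice k ⟩
    suc k + suc k        ≤⟨ +-mono-≤ (≰⇒> ab) (≰⇒> ba) ⟩
    fwd a b + fwd b a    ≡⟨ fwd-turn a b a<N b<N a≢b ⟩
    N                    ∎))
    where
    open ≤-Reasoning
    twice : ∀ k → suc (suc (2 * k)) ≡ suc k + suc k
    twice = solve-∀

  free-↭ : ∀ {T T' l} → T ↭ T' → Free T l → Free T' l
  free-↭ T↭T' (l<N , uncovered , unrepeated) =
      l<N
    , (λ (p , q , p∈ , q∈ , rest) →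
         uncovered (p , q , ∈-resp-↭ (↭-sym T↭T') p∈ , ∈-resp-↭ (↭-sym T↭T') q∈ , rest))
    , (λ (T'' , T'↭) → unrepeated (T'' , ↭-trans T↭T' T'↭))

  free-++ : ∀ {T l} E → Free (T ++ E) l → Free T l
  free-++ E (l<N , uncovered , unrepeated) =
      l<N
    , (λ (p , q , p∈ , q∈ , rest) → uncovered (p , q , ∈-++⁺ˡ p∈ , ∈-++⁺ˡ q∈ , rest))
    , (λ (T'' , T↭) → unrepeated (T'' ++ E , ++⁺ʳ E T↭))

  free-if-far : ∀ T l α β → l < N → ¬ Repeated l T →
    (∀ t → t ∈ T → t ≢ l → α ≤ fwd t l × β ≤ fwd l t) → k < α + β → Free T l
  free-if-far T l α β l<N unrepeated far k<α+β = l<N , uncovered , unrepeated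
    where
    uncovered : ¬ Covered T l
    uncovered (p , q , p∈ , q∈ , p≢l , q≢l , short) =
      <⇒≱ k<α+β (≤-trans (+-mono-≤ (proj₁ (far p p∈ p≢l)) (proj₂ (far q q∈ q≢l))) short)

  free-off-T : ∀ T l α β (R : ℕ → Set) → l < N → All R T →
    (∀ {t} → R t → t ≢ l × α ≤ fwd t l × β ≤ fwd l t) → k < α + β → Free T l
  free-off-T T l α β R l<N all-R far k<α+β =
    free-if-far T l α β l<N unrepeated (λ t t∈ _ → proj₂ (far (All.lookup all-R t∈))) k<α+β
    where
    unrepeated : ¬ Repeated l T
    unrepeated (_ , T↭) = proj₁ (far (All.lookup all-R (∈-resp-↭ (↭-sym T↭) (here refl)))) refl

  free-once-in-T : ∀ T₁ T₂ l α β (R : ℕ → Set) → l < N → All R (T₁ ++ T₂) →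
    (∀ {t} → R t → t ≢ l × α ≤ fwd t l × β ≤ fwd l t) → k < α + β → Free (T₁ ++ l ∷ T₂) l
  free-once-in-T T₁ T₂ l α β R l<N all-R far k<α+β =
    free-if-far (T₁ ++ l ∷ T₂) l α β l<N unrepeated others k<α+β
    where
    T↭ : T₁ ++ l ∷ T₂ ↭ l ∷ T₁ ++ T₂
    T↭ = shift l T₁ T₂
    unrepeated : ¬ Repeated l (T₁ ++ l ∷ T₂)
    unrepeated (_ , T↭₂) =
      proj₁ (far (All.lookup all-R (∈-resp-↭ (drop-∷ (↭-trans (↭-sym T↭₂) T↭)) (here refl)))) refl
    others : ∀ t → t ∈ T₁ ++ l ∷ T₂ → t ≢ l → α ≤ fwd t l × β ≤ fwd l t
    others t t∈ t≢l with ∈-resp-↭ T↭ t∈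
    ... | here t≡l  = ⊥-elim (t≢l t≡l)
    ... | there t∈' = proj₂ (far (All.lookup all-R t∈'))

  Outside : ℕ → ℕ → ℕ → Set
  Outside u v t = t < N × (t ≤ u ⊎ v ≤ t)

  Within : ℕ → ℕ → ℕ → Set
  Within lo hi t = lo ≤ t × t ≤ hi

  outside-bounds : ∀ {u l v t} → u < l → l < v → v < N → Outside u v t →
                   t ≢ l × l ∸ u ≤ fwd t l × v ∸ l ≤ fwd l t
  outside-bounds {u} {l} {v} {t} u<l l<v v<N (t<N , inj₁ t≤u) =
      (λ { refl → <-irrefl refl (≤-<-trans t≤u u<l) })
    , subst (l ∸ u ≤_) (sym (fwd-≤ (≤-trans t≤u (<⇒≤ u<l)))) (∸-monoʳ-≤ l t≤u)
    , subst (v ∸ l ≤_) (sym (fwd-> (≤-<-trans t≤u u<l))) (∸-monoˡ-≤ l (≤-trans (<⇒≤ v<N) (m≤m+n N t)))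
  outside-bounds {u} {l} {v} {t} u<l l<v v<N (t<N , inj₂ v≤t) =
      (λ { refl → <-irrefl refl (<-≤-trans l<v v≤t) })
    , subst (l ∸ u ≤_) (sym (fwd-> (<-≤-trans l<v v≤t)))
        (≤-trans (m∸n≤m l u) (m+n≤o⇒m≤o∸n l (subst (_≤ N + l) (+-comm t l) (+-monoˡ-≤ l (<⇒≤ t<N)))))
    , subst (v ∸ l ≤_) (sym (fwd-≤ (≤-trans (<⇒≤ l<v) v≤t))) (∸-monoˡ-≤ l v≤t)

  below-bounds : ∀ {lo hi l t} → l < lo → hi < N → Within lo hi t →
                 t ≢ l × N + l ∸ hi ≤ fwd t l × lo ∸ l ≤ fwd l t
  below-bounds {lo} {hi} {l} {t} l<lo hi<N (lo≤t , t≤hi) =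
      (λ { refl → <-irrefl refl (<-≤-trans l<lo lo≤t) })
    , subst (N + l ∸ hi ≤_) (sym (fwd-> (<-≤-trans l<lo lo≤t))) (∸-monoʳ-≤ (N + l) t≤hi)
    , subst (lo ∸ l ≤_) (sym (fwd-≤ (≤-trans (<⇒≤ l<lo) lo≤t))) (∸-monoˡ-≤ l lo≤t)

  above-bounds : ∀ {lo hi l t} → hi < l → l < N → Within lo hi t →
                 t ≢ l × l ∸ hi ≤ fwd t l × N + lo ∸ l ≤ fwd l t
  above-bounds {lo} {hi} {l} {t} hi<l l<N (lo≤t , t≤hi) =
      (λ { refl → <-irrefl refl (≤-<-trans t≤hi hi<l) })
    , subst (l ∸ hi ≤_) (sym (fwd-≤ (≤-trans t≤hi (<⇒≤ hi<l)))) (∸-monoʳ-≤ l t≤hi)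
    , subst (N + lo ∸ l ≤_) (sym (fwd-> (≤-<-trans t≤hi hi<l))) (∸-monoˡ-≤ l (+-monoʳ-≤ N lo≤t))

  -- Four gaps around the cycle add up to N = 2k + 1, so one of them exceeds k or,
  -- failing that, two cyclically consecutive gaps together exceed k; the gaps on
  -- both sides of the position between them are then nonempty (where needed).
  data Wide (g₁ g₂ g₃ g₄ : ℕ) : Set where
    gap₁ : k < g₁ → Wide g₁ g₂ g₃ g₄
    gap₂ : k < g₂ → Wide g₁ g₂ g₃ g₄
    gap₃ : k < g₃ → Wide g₁ g₂ g₃ g₄
    gap₄ : k < g₄ → Wide g₁ g₂ g₃ g₄
    pair₄₁ : 0 < g₁ → k < g₄ + g₁ → Wide g₁ g₂ g₃ g₄
    pair₁₂ : 0 < g₁ → 0 < g₂ → k < g₁ + g₂ → Wide g₁ g₂ g₃ g₄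
    pair₂₃ : 0 < g₂ → 0 < g₃ → k < g₂ + g₃ → Wide g₁ g₂ g₃ g₄
    pair₃₄ : 0 < g₃ → k < g₃ + g₄ → Wide g₁ g₂ g₃ g₄

  positive-left : ∀ {x y} → ¬ (k < y) → k < x + y → 0 < x
  positive-left {zero}  y≤k k<y = ⊥-elim (y≤k k<y)
  positive-left {suc x} _   _   = s≤s z≤n

  positive-right : ∀ {x y} → ¬ (k < x) → k < x + y → 0 < y
  positive-right {x} {y} x≤k k<x+y = positive-left x≤k (subst (k <_) (+-comm x y) k<x+y)

  wide : ∀ g₁ g₂ g₃ g₄ → g₁ + g₂ + g₃ + g₄ ≡ N → Wide g₁ g₂ g₃ g₄
  wide g₁ g₂ g₃ g₄ total with k <? g₁ | k <? g₂ | k <? g₃ | k <? g₄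
  ... | yes w | _     | _     | _     = gap₁ w
  ... | no _  | yes w | _     | _     = gap₂ w
  ... | no _  | no _  | yes w | _     = gap₃ w
  ... | no _  | no _  | no _  | yes w = gap₄ w
  ... | no n₁ | no n₂ | no n₃ | no n₄ with k <? g₄ + g₁ | k <? g₁ + g₂ | k <? g₂ + g₃ | k <? g₃ + g₄
  ...   | yes w | _     | _     | _     = pair₄₁ (positive-right n₄ w) w
  ...   | no _  | yes w | _     | _     = pair₁₂ (positive-left n₂ w) (positive-right n₁ w) w
  ...   | no _  | no _  | yes w | _     = pair₂₃ (positive-left n₃ w) (positive-right n₂ w) w
  ...   | no _  | no _  | no _  | yes w = pair₃₄ (positive-left n₄ w) w
  ...   | no m₁ | no m₂ | no m₃ | no m₄ = ⊥-elim (<-irrefl refl (begin-strict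
    4 * k                                           <⟨ ≤-trans (n<1+n (4 * k)) (n≤1+n _) ⟩
    2 + 4 * k                                       ≡⟨ two-turns k ⟩
    2 * N                                           ≡⟨ cong (2 *_) (sym total) ⟩
    2 * (g₁ + g₂ + g₃ + g₄)                         ≡⟨ consecutive-pairs g₁ g₂ g₃ g₄ ⟩
    (g₄ + g₁) + (g₁ + g₂) + (g₂ + g₃) + (g₃ + g₄)  ≤⟨ +-mono-≤ (+-mono-≤ (+-mono-≤ (≮⇒≥ m₁) (≮⇒≥ m₂))
                                                           (≮⇒≥ m₃)) (≮⇒≥ m₄) ⟩
    k + k + k + k                                   ≡⟨ four-k k ⟩
    4 * k                                           ∎))
    where
    open ≤-Reasoning
    two-turns : ∀ k → 2 + 4 * k ≡ 2 * suc (2 * k)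
    two-turns = solve-∀
    consecutive-pairs : ∀ a b c d → 2 * (a + b + c + d) ≡ (d + a) + (a + b) + (b + c) + (c + d)
    consecutive-pairs = solve-∀
    four-k : ∀ k → k + k + k + k ≡ 4 * k
    four-k = solve-∀

  free-in-gap : ∀ T u v → u ≤ v → v < N → k < v ∸ u → All (Outside u v) T → Σ ℕ (Free T)
  free-in-gap T u v u≤v v<N k<v∸u all-out =
    suc u , free-off-T T (suc u) (suc u ∸ u) (v ∸ suc u) (Outside u v) (<-trans u+1<v v<N) all-out
              (outside-bounds ≤-refl u+1<v v<N)
              (subst (k <_) (sym (∸-split (n≤1+n u) (<⇒≤ u+1<v))) k<v∸u)
    where
    u+1<v : suc u < v
    u+1<v = m≤o∸n⇒m+n≤o 2 u≤v (≤-trans (s≤s k≥1) k<v∸u)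

  free-across-wrap : ∀ T lo hi → hi < N → k < N + lo ∸ hi → All (Within lo hi) T → Σ ℕ (Free T)
  free-across-wrap T lo hi hi<N k<gap all-in with suc hi <? N
  ... | yes hi+1<N =
    suc hi , free-off-T T (suc hi) (suc hi ∸ hi) (N + lo ∸ suc hi) (Within lo hi) hi+1<N all-in
               (above-bounds ≤-refl hi+1<N)
               (subst (k <_) (sym (∸-split (n≤1+n hi) (≤-trans (<⇒≤ hi+1<N) (m≤m+n N lo)))) k<gap)
  ... | no hi+1≮N =
    0 , free-off-T T 0 (N + 0 ∸ hi) lo (Within lo hi) (s≤s z≤n) all-in
          (below-bounds 0<lo hi<N)
          (subst (λ m → k < m + lo) (sym one) k<1+lo)
    where
    -- here hi = N - 1, so the gap has length lo + 1
    N∸hi≡1 : N ∸ hi ≡ 1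
    N∸hi≡1 = trans (cong (_∸ hi) (sym (≤-antisym hi<N (≮⇒≥ hi+1≮N)))) (m+n∸n≡m 1 hi)
    one : N + 0 ∸ hi ≡ 1
    one = trans (cong (_∸ hi) (+-identityʳ N)) N∸hi≡1
    k<1+lo : k < suc lo
    k<1+lo = subst (k <_) (trans (+-∸-comm lo (<⇒≤ hi<N)) (cong (_+ lo) N∸hi≡1)) k<gap
    0<lo : 0 < lo
    0<lo = ≤-trans k≥1 (≤-pred k<1+lo)

  positive-gap : ∀ {u v} → 0 < v ∸ u → u < v
  positive-gap p = m∸n≢0⇒n<m (λ e → <-irrefl (sym e) p)

  -- Four positions a₁ ≤ a₂ ≤ a₃ ≤ a₄ < N have a free layer: by `wide`, either a
  -- gap between cyclically consecutive positions is long, or some position has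
  -- long enough gaps on both sides.
  module SortedFour (a₁ a₂ a₃ a₄ : ℕ) (o₁ : a₁ ≤ a₂) (o₂ : a₂ ≤ a₃) (o₃ : a₃ ≤ a₄)
                    (a₄<N : a₄ < N) where

    T : List ℕ
    T = a₁ ∷ a₂ ∷ a₃ ∷ a₄ ∷ []

    o₁₂ : a₁ ≤ a₃
    o₁₂ = ≤-trans o₁ o₂
    o₂₃ : a₂ ≤ a₄
    o₂₃ = ≤-trans o₂ o₃
    o₁₂₃ : a₁ ≤ a₄
    o₁₂₃ = ≤-trans o₁₂ o₃
    a₃<N : a₃ < N
    a₃<N = ≤-<-trans o₃ a₄<N
    a₂<N : a₂ < N
    a₂<N = ≤-<-trans o₂ a₃<N
    a₁<N : a₁ < N
    a₁<N = ≤-<-trans o₁ a₂<N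
    g₁ g₂ g₃ g₄ : ℕ
    g₁ = a₂ ∸ a₁
    g₂ = a₃ ∸ a₂
    g₃ = a₄ ∸ a₃
    g₄ = N + a₁ ∸ a₄
    total : g₁ + g₂ + g₃ + g₄ ≡ N
    total = +-cancelˡ-≡ a₁ _ _ (begin
      a₁ + (g₁ + g₂ + g₃ + g₄)        ≡⟨ reassociate a₁ g₁ g₂ g₃ g₄ ⟩
      (((a₁ + g₁) + g₂) + g₃) + g₄    ≡⟨ cong (λ m → ((m + g₂) + g₃) + g₄) (m+[n∸m]≡n o₁) ⟩
      ((a₂ + g₂) + g₃) + g₄           ≡⟨ cong (λ m → (m + g₃) + g₄) (m+[n∸m]≡n o₂) ⟩
      (a₃ + g₃) + g₄                  ≡⟨ cong (_+ g₄) (m+[n∸m]≡n o₃) ⟩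
      a₄ + g₄                         ≡⟨ m+[n∸m]≡n (≤-trans (<⇒≤ a₄<N) (m≤m+n N a₁)) ⟩
      N + a₁                          ≡⟨ +-comm N a₁ ⟩
      a₁ + N                          ∎)
      where
      open ≡-Reasoning
      reassociate : ∀ a b c d e → a + (b + c + d + e) ≡ (((a + b) + c) + d) + e
      reassociate = solve-∀

    free-layer₄ : Σ ℕ (Free T)
    free-layer₄ with wide g₁ g₂ g₃ g₄ total
    ... | gap₁ w = free-in-gap T a₁ a₂ o₁ a₂<N w
                     ((a₁<N , inj₁ ≤-refl) ∷ (a₂<N , inj₂ ≤-refl) ∷ (a₃<N , inj₂ o₂) ∷ (a₄<N , inj₂ o₂₃) ∷ [])
    ... | gap₂ w = free-in-gap T a₂ a₃ o₂ a₃<N w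
                     ((a₁<N , inj₁ o₁) ∷ (a₂<N , inj₁ ≤-refl) ∷ (a₃<N , inj₂ ≤-refl) ∷ (a₄<N , inj₂ o₃) ∷ [])
    ... | gap₃ w = free-in-gap T a₃ a₄ o₃ a₄<N w
                     ((a₁<N , inj₁ o₁₂) ∷ (a₂<N , inj₁ o₂) ∷ (a₃<N , inj₁ ≤-refl) ∷ (a₄<N , inj₂ ≤-refl) ∷ [])
    ... | gap₄ w = free-across-wrap T a₁ a₄ a₄<N w
                     ((≤-refl , o₁₂₃) ∷ (o₁ , o₂₃) ∷ (o₁₂ , o₃) ∷ (o₁₂₃ , ≤-refl) ∷ [])
    ... | pair₄₁ p₁ w = a₁ , free-once-in-T [] (a₂ ∷ a₃ ∷ a₄ ∷ []) a₁ _ _ (Within a₂ a₄) a₁<N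
                            ((≤-refl , o₂₃) ∷ (o₂ , o₃) ∷ (o₂₃ , ≤-refl) ∷ [])
                            (below-bounds (positive-gap p₁) a₄<N) w
    ... | pair₁₂ p₁ p₂ w = a₂ , free-once-in-T (a₁ ∷ []) (a₃ ∷ a₄ ∷ []) a₂ _ _ (Outside a₁ a₃) a₂<N
                            ((a₁<N , inj₁ ≤-refl) ∷ (a₃<N , inj₂ ≤-refl) ∷ (a₄<N , inj₂ o₃) ∷ [])
                            (outside-bounds (positive-gap p₁) (positive-gap p₂) a₃<N) w
    ... | pair₂₃ p₂ p₃ w = a₃ , free-once-in-T (a₁ ∷ a₂ ∷ []) (a₄ ∷ []) a₃ _ _ (Outside a₂ a₄) a₃<N
                            ((a₁<N , inj₁ o₁) ∷ (a₂<N , inj₁ ≤-refl) ∷ (a₄<N , inj₂ ≤-refl) ∷ [])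
                            (outside-bounds (positive-gap p₂) (positive-gap p₃) a₄<N) w
    ... | pair₃₄ p₃ w = a₄ , free-once-in-T (a₁ ∷ a₂ ∷ a₃ ∷ []) [] a₄ _ _ (Within a₁ a₃) a₄<N
                            ((≤-refl , o₁₂) ∷ (o₁ , o₂) ∷ (o₁₂ , ≤-refl) ∷ [])
                            (above-bounds (positive-gap p₃) a₄<N) w

  -- Any list of at most four positions has a free layer: pad it with zeros to
  -- four positions (a free layer of the longer list is free for the shorter one)
  -- and sort.
  free-layer : ∀ T → All (_< N) T → length T ≤ 4 → Σ ℕ (Free T)
  free-layer T all<N |T|≤4 with free-layer-sorted (sort padded) (sort-↭ padded) (sort-↗ padded)
                                    (trans (↭-length (sort-↭ padded)) |padded|)
    where
    padding : List ℕ
    padding = replicate (4 ∸ length T) 0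
    padded : List ℕ
    padded = T ++ padding
    |padded| : length padded ≡ 4
    |padded| = trans (length-++ T) (trans (cong (length T +_) (length-replicate (4 ∸ length T)))
                 (m+[n∸m]≡n |T|≤4))
    padded<N : All (_< N) padded
    padded<N = All-++⁺ all<N (replicate⁺ (4 ∸ length T) (s≤s z≤n))
    free-layer-sorted : ∀ s → s ↭ padded → Linked _≤_ s → length s ≡ 4 → Σ ℕ (Free padded)
    free-layer-sorted (a₁ ∷ a₂ ∷ a₃ ∷ a₄ ∷ []) s↭ (o₁ ∷ o₂ ∷ o₃ ∷ _) _ =
      let a₄<N = All.lookup padded<N (∈-resp-↭ s↭ (there (there (there (here refl)))))
          (l , free) = SortedFour.free-layer₄ a₁ a₂ a₃ a₄ o₁ o₂ o₃ a₄<N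
      in l , free-↭ s↭ free
    free-layer-sorted []                          _ _ ()
    free-layer-sorted (_ ∷ [])                    _ _ ()
    free-layer-sorted (_ ∷ _ ∷ [])                _ _ ()
    free-layer-sorted (_ ∷ _ ∷ _ ∷ [])            _ _ ()
    free-layer-sorted (_ ∷ _ ∷ _ ∷ _ ∷ _ ∷ _)     _ _ ()
  ... | l , free = l , free-++ _ free

member⇒↭ : ∀ {A : Set} {u : A} {S : List A} → u ∈ S → Σ (List A) λ S' → S ↭ u ∷ S'
member⇒↭ u∈S with ∈-∃++ u∈S
... | ys , zs , refl = ys ++ zs , shift _ ys zs

two-members : ∀ {A B : Set} (f : A → B) {u v : A} {S : List A} → u ∈ S → v ∈ S → u ≢ v →
              Σ (List B) λ rest → map f S ↭ f u ∷ f v ∷ rest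
two-members f {u} {v} u∈S v∈S u≢v with member⇒↭ u∈S
... | S₁ , S↭ with ∈-resp-↭ S↭ v∈S
...   | here v≡u   = ⊥-elim (u≢v (sym v≡u))
...   | there v∈S₁ with member⇒↭ v∈S₁
...     | S₂ , S₁↭ = map f S₂ , ↭-map⁺ f (↭-trans S↭ (↭-prep u S₁↭))

module SmallGeodeticSets (G : RawGraph) (fsc : IsFiniteSimpleConnected G) (k : ℕ) (k≥1 : 1 ≤ k) where

  open CycleGeodesics (2 * k) (≤-trans k≥1 (m≤m+n k (k + 0)))
  open FreeLayer k k≥1 using (Covered; Repeated; Free; free-layer; dist≤k)
  open ProductGeodesics G C d d-lower d-attained using (extreme-column)

  H : RawGraph
  H = G ⊠ C

  _≟ᴳ_ : DecidableEquality (V G)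
  _≟ᴳ_ = inj⇒≟ (↔⇒↣ (proj₂ (IsFiniteSimpleConnected.finite fsc)))

  _≟ᴴ_ : DecidableEquality (V H)
  _≟ᴴ_ = ≡-dec _≟ᴳ_ _≟ᶠ_

  columns : List (V H) → List (V G)
  columns = map proj₁

  layer : V H → ℕ
  layer v = toℕ (proj₂ v)

  layers : List (V H) → List ℕ
  layers = map layer

  layers<N : ∀ S → All (_< N) (layers S)
  layers<N []      = []
  layers<N (v ∷ S) = toℕ<n (proj₂ v) ∷ layers<N S

  ExtremeFor : List (V G) → V G → Set
  ExtremeFor P x = ∀ {a b} → a ∈ P → b ∈ P → Extreme G a b x

  -- If S is geodetic and x is extreme for its columns, every layer l either meets
  -- S in column x or is covered by the layers of S: (x,l) lies in some I[(a,p),(b,q)],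
  -- and by the column lemma l lies inside a geodesic of C from p to q.
  column-or-covered : ∀ S → Geodetic H S → ∀ {x} → ExtremeFor (columns S) x →
                      ∀ l → (x , l) ∈ S ⊎ Covered (layers S) (toℕ l)
  column-or-covered S geodetic {x} extreme l with geodetic (x , l)
  ... | (a , p) , (b , q) , u∈S , v∈S , x,l∈I with (x , l) ≟ᴴ (a , p) | (x , l) ≟ᴴ (b , q)
  ...   | yes refl | _        = inj₁ u∈S
  ...   | no _     | yes refl = inj₁ v∈S
  ...   | no ≢u    | no ≢v
    with extreme-column _≟ᴳ_ (extreme (∈-map⁺ proj₁ u∈S) (∈-map⁺ proj₁ v∈S)) x,l∈I ≢u ≢v
  ...     | l≢p , l≢q , between
    with between⇒arc (toℕ p) (toℕ l) (toℕ q) (toℕ<n p) (toℕ<n l) (toℕ<n q)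
           (l≢p ∘ toℕ-injective) (l≢q ∘ toℕ-injective) between
  ...       | inj₁ arc = inj₂ (toℕ p , toℕ q , ∈-map⁺ layer u∈S , ∈-map⁺ layer v∈S ,
                               (l≢p ∘ toℕ-injective ∘ sym) , (l≢q ∘ toℕ-injective ∘ sym) ,
                               ≤-trans arc (dist≤k (toℕ p) (toℕ q) (toℕ<n p) (toℕ<n q)))
  ...       | inj₂ arc = inj₂ (toℕ q , toℕ p , ∈-map⁺ layer v∈S , ∈-map⁺ layer u∈S ,
                               (l≢q ∘ toℕ-injective ∘ sym) , (l≢p ∘ toℕ-injective ∘ sym) ,
                               ≤-trans arc (dist≤k (toℕ p) (toℕ q) (toℕ<n p) (toℕ<n q)))

  meets-free-layer : ∀ S → Geodetic H S → ∀ {x} → ExtremeFor (columns S) x →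
                     ∀ l → Free (layers S) (toℕ l) → (x , l) ∈ S
  meets-free-layer S geodetic extreme l (_ , uncovered , _) with column-or-covered S geodetic extreme l
  ... | inj₁ x,l∈S   = x,l∈S
  ... | inj₂ covered = ⊥-elim (uncovered covered)

  -- The conclusion of Hyp for a set P containing the columns of S.
  extreme-for : ∀ {S P z} → (∀ {a} → a ∈ columns S → a ∈ P) →
                ¬ InIntervalSet G (Minus P z) z → ExtremeFor (columns S) z
  extreme-for ⊆P z-extreme a∈ b∈ a≢z b≢z z∈I = z-extreme (_ , _ , (⊆P a∈ , a≢z) , (⊆P b∈ , b≢z) , z∈I)

  another-vertex : Nontrivial G → ∀ a → Σ (V G) λ x → x ≢ a
  another-vertex (v₁ , v₂ , v₁≢v₂) a with v₁ ≟ᴳ a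
  ... | yes v₁≡a = v₂ , λ v₂≡a → v₁≢v₂ (trans v₁≡a (sym v₂≡a))
  ... | no v₁≢a  = v₁ , v₁≢a

  -- Fix a free layer l of S; the column of every vertex extreme for
  -- the columns of S meets l inside S.  If S has a single column, any other
  -- vertex is extreme, which is absurd; otherwise Hyp yields two distinct
  -- extreme vertices, and the layer l would be repeated.
  no-small-geodetic : Nontrivial G → Hyp G → ∀ S → Geodetic H S → length S ≤ 4 → ⊥
  no-small-geodetic nontrivial hyp S geodetic |S|≤4
    with free-layer (layers S) (layers<N S) (≤-trans (≤-reflexive (length-map layer S)) |S|≤4)
  ... | l₀ , free₀ =
    by-columns (deduplicate _≟ᴳ_ (columns S)) (∈-deduplicate⁺ _≟ᴳ_) (deduplicate-! _≟ᴳ_ (columns S))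
      (≤-trans (length-deduplicate _≟ᴳ_ (columns S)) (≤-trans (≤-reflexive (length-map proj₁ S)) |S|≤4))
    where
    l : Fin N
    l = fromℕ< (proj₁ free₀)
    free : Free (layers S) (toℕ l)
    free = subst (Free (layers S)) (sym (toℕ-fromℕ< _)) free₀

    meets : ∀ {x} → ExtremeFor (columns S) x → (x , l) ∈ S
    meets extreme = meets-free-layer S geodetic extreme l free

    some-column : Σ (V G) λ a → a ∈ columns S
    some-column with geodetic (proj₁ nontrivial , zero)
    ... | u , _ , u∈S , _ = proj₁ u , ∈-map⁺ proj₁ u∈S

    by-columns : (P : List (V G)) → (∀ {a} → a ∈ columns S → a ∈ P) → Unique P → length P ≤ 4 → ⊥
    by-columns [] ⊆P _ _ with ⊆P (proj₂ some-column)
    ... | ()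
    by-columns (a ∷ []) ⊆P _ _ with another-vertex nontrivial a
    ... | x , x≢a = x≢a (only-a (∈-map⁺ proj₁ (meets extreme)))
      where
      only-a : ∀ {a'} → a' ∈ columns S → a' ≡ a
      only-a a'∈ with ⊆P a'∈
      ... | here a'≡a = a'≡a
      extreme : ExtremeFor (columns S) x
      extreme a'∈ b'∈ _ _ x∈I =
        x≢a (interval-self (subst₂ (λ s t → InInterval G s t x) (only-a a'∈) (only-a b'∈) x∈I))
    by-columns (a ∷ b ∷ P) ⊆P unique |P|≤4
      with hyp (a ∷ b ∷ P) unique (s≤s (s≤s z≤n)) |P|≤4
    ... | x , y , _ , _ , x≢y , x-extreme , y-extreme
      with two-members layer (meets (extreme-for ⊆P x-extreme)) (meets (extreme-for ⊆P y-extreme))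
             (x≢y ∘ cong proj₁)
    ...   | rest , S↭ = proj₂ (proj₂ free) (rest , S↭)

proposition7 : (G : RawGraph) → IsFiniteSimpleConnected G → Nontrivial G → Hyp G →
    (k : ℕ) → 2 ≤ k → GeodeticNumberAtLeast (G ⊠ Cycle (2 * k)) 5
proposition7 G fsc nontrivial hyp k 2≤k S _ geodetic with 5 ≤? length S
... | yes 5≤|S| = 5≤|S|
... | no 5≰|S|  = ⊥-elim (SmallGeodeticSets.no-small-geodetic G fsc k (≤-trans (s≤s z≤n) 2≤k)
                           nontrivial hyp S geodetic (≤-pred (≰⇒> 5≰|S|)))
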